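{- Let $(G,S)$ be a rooted graph and $\sim$ a non-edge-collapsing equivalence relation on $G$. Then $(\mathcal{T}(G,S),\epsilon_S)$ and $(\mathcal{T}(G/\sim,[S]_\sim),\epsilon_{[S]_\sim})$ are rooted-isomorphic.
   Context: A graph is $G=(V,E,o,t)$ with vertex set $V$, edge set $E$, maps $o,t:E\to V$ (origin, terminus); loops and multiple edges allowed. A walk is an empty walk $\epsilon_v$ ($O=T=v$) or $e_1\dots e_n$ with $t(e_i)=o(e_{i+1})$, $O=o(e_1)$, $T=t(e_n)$. A root is a vertex from which every vertex is reachable by a walk. The unfolding tree $\mathcal{T}(G,S)$ has vertices the walks with origin $S$, an edge from $w$ to $we$ whenever $e$ is an edge and $we$ a walk, and root $\epsilon_S$; rooted-isomorphic means isomorphic via an isomorphism (bijections on vertices and edges compatible with origins and termini) matching the roots. An equivalence relation $\sim$ on $G$ is a pair of equivalence relations $\sim_V$ on $V$, $\sim_E$ on $E$ with $e_1\sim_E e_2\Rightarrow o(e_1)\sim_V o(e_2)$, $t(e_1)\sim_V t(e_2)$; the quotient $G/\sim$ has vertices $V/\sim_V$, edges $E/\sim_E$, $o([e])=[o(e)]$, $t([e])=[t(e)]$. It is non-edge-collapsing if for all $v\sim_V v'$ and each edge $e$ with $o(e)=v$ there is exactly one edge $e'$ with $o(e')=v'$ and $e\sim_E e'$. -}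

module Defs where

open import Data.Product using (Σ; _×_; _,_; ∃-syntax)
open import Relation.Binary.PropositionalEquality using (_≡_)
open import Relation.Binary.Core using (Rel)
open import Relation.Binary.Structures using (IsEquivalence)
open import Function.Bundles using (_↔_; Inverse)
open import Level using (0ℓ)

record Graph : Set₁ where
  field
    V : Set
    E : Set
    o : E → V
    t : E → V
open Graph public

-- A walk is either the empty walk ε_u,
-- or  snoc e w  = the walk w (ending at o(e)) followed by the edge e,
-- which ends at t(e).  (Lists e₁…eₙ with t(eᵢ) = o(eᵢ₊₁), built from the end.)
data Walk (G : Graph) (u : V G) : V G → Set where
  ε    : Walk G u u
  snoc : (e : E G) → Walk G u (o G e) → Walk G u (t G e)

IsRoot : (G : Graph) → V G → Set
IsRoot G S = (v : V G) → Walk G S v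

-- The unfolding tree T(G,S): vertices are walks with origin S (paired with
-- their terminus); there is one edge from w to we for each edge e with
-- o(e) = T(w); we index that edge by the pair (e , w).
Unfolding : (G : Graph) → V G → Graph
Unfolding G S = record
  { V = Σ (V G) (Walk G S)
  ; E = Σ (E G) (λ e → Walk G S (o G e))
  ; o = λ { (e , w) → (o G e , w) }
  ; t = λ { (e , w) → (t G e , snoc e w) }
  }

rootOf : (G : Graph) (S : V G) → V (Unfolding G S)
rootOf G S = (S , ε)

record RootedIso (G H : Graph) (r : V G) (s : V H) : Set where
  field
    isoV  : V G ↔ V H
    isoE  : E G ↔ E H
    pres-o : ∀ e → o H (Inverse.to isoE e) ≡ Inverse.to isoV (o G e)
    pres-t : ∀ e → t H (Inverse.to isoE e) ≡ Inverse.to isoV (t G e)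
    pres-root : Inverse.to isoV r ≡ s

record GraphEquiv (G : Graph) : Set₁ where
  field
    _~V_ : Rel (V G) 0ℓ
    _~E_ : Rel (E G) 0ℓ
    isEquivV : IsEquivalence _~V_
    isEquivE : IsEquivalence _~E_
    compat-o : ∀ {e₁ e₂} → e₁ ~E e₂ → o G e₁ ~V o G e₂
    compat-t : ∀ {e₁ e₂} → e₁ ~E e₂ → t G e₁ ~V t G e₂
open GraphEquiv public

NonEdgeCollapsing : (G : Graph) → GraphEquiv G → Set
NonEdgeCollapsing G R =
  ∀ v v' → _~V_ R v v' → ∀ e → o G e ≡ v →
    Σ (E G) λ e' → (o G e' ≡ v' × _~E_ R e e')
      × (∀ e'' → o G e'' ≡ v' × _~E_ R e e'' → e'' ≡ e')

-- Since --safe Agda has no quotient types, the quotient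
-- is given by its defining data: a graph Q with surjective class maps
-- [_]V : V G → V Q, [_]E : E G → E Q whose kernels are exactly ~V and ~E,
-- and with o([e]) = [o(e)], t([e]) = [t(e)].
record IsQuotient (G : Graph) (R : GraphEquiv G) (Q : Graph) : Set where
  field
    clsV : V G → V Q
    clsE : E G → E Q
    clsV-surj : ∀ x → Σ (V G) λ v → clsV v ≡ x
    clsE-surj : ∀ y → Σ (E G) λ e → clsE e ≡ y
    clsV-kernel→ : ∀ v v' → clsV v ≡ clsV v' → _~V_ R v v'
    clsV-kernel← : ∀ v v' → _~V_ R v v' → clsV v ≡ clsV v'
    clsE-kernel→ : ∀ e e' → clsE e ≡ clsE e' → _~E_ R e e'
    clsE-kernel← : ∀ e e' → _~E_ R e e' → clsE e ≡ clsE e'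
    cls-o : ∀ e → o Q (clsE e) ≡ clsV (o G e)
    cls-t : ∀ e → t Q (clsE e) ≡ clsV (t G e)
open IsQuotient public

{-# OPTIONS --safe #-}
module Submission where

-- The class map G → G/~ is a graph morphism which, by the non-edge-collapsing
-- condition, maps the out-edges of every vertex v bijectively onto the
-- out-edges of [v].  Along such a map every walk from [S] lifts uniquely,
-- edge by edge, to a walk from S; hence mapping walks is a bijection between
-- the vertices of the two unfolding trees, and mapping (edge, walk) pairs one
-- between their edges.

open import Defs
open import Data.Product using (Σ; _,_; proj₁; proj₂; Σ-syntax)
open import Data.Product.Properties using (Σ-≡,≡→≡)
open import Function.Bundles using (Inverse; mk⤖; mk↔ₛ′)
open import Function.Definitions using (Injective; StrictlySurjective; Bijective)
open import Function.Consequences.Propositional using (strictlySurjective⇒surjective)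
open import Function.Properties.Bijection using (⤖⇒↔)
open import Relation.Binary.PropositionalEquality
open import Relation.Binary.Structures using (IsEquivalence)

record GraphMorphism (G H : Graph) : Set where
  field
    onV : V G → V H
    onE : E G → E H
    o-commute : ∀ e → o H (onE e) ≡ onV (o G e)
    t-commute : ∀ e → t H (onE e) ≡ onV (t G e)
open GraphMorphism

Out : (G : Graph) → V G → Set
Out G v = Σ (E G) λ e → o G e ≡ v

-- Uses K: proofs of o e ≡ v are unique.
Out-≡ : ∀ {G v} {x y : Out G v} → proj₁ x ≡ proj₁ y → x ≡ y
Out-≡ {x = _ , refl} {y = _ , refl} refl = refl

outMap : ∀ {G H} (f : GraphMorphism G H) v → Out G v → Out H (onV f v)
outMap f _ (e , p) = onE f e , trans (o-commute f e) (cong (onV f) p)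

IsCovering : ∀ {G H} → GraphMorphism G H → Set
IsCovering f = ∀ v → Bijective _≡_ _≡_ (outMap f v)

edge-at : ∀ {G S} (n : V (Unfolding G S)) → Out G (proj₁ n) → E (Unfolding G S)
edge-at {G} {S} (_ , w) (e , p) = e , subst (Walk G S) (sym p) w

o-edge-at : ∀ {G S} (n : V (Unfolding G S)) x → o (Unfolding G S) (edge-at n x) ≡ n
o-edge-at _ (_ , refl) = refl

module CoveringUnfolding {G H : Graph} (f : GraphMorphism G H) (cov : IsCovering f)
                         (S : V G) where

  private
    UG = Unfolding G S
    UH = Unfolding H (onV f S)
    outInverse = λ v → ⤖⇒↔ (mk⤖ (cov v))

  liftOut : ∀ v → Out H (onV f v) → Out G v
  liftOut v = Inverse.from (outInverse v)

  outMap-liftOut : ∀ v y → outMap f v (liftOut v y) ≡ y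
  outMap-liftOut v = Inverse.strictlyInverseˡ (outInverse v)

  liftOut-outMap : ∀ v x → liftOut v (outMap f v x) ≡ x
  liftOut-outMap v = Inverse.strictlyInverseʳ (outInverse v)

  mapWalk : ∀ {v} → Walk G S v → Walk H (onV f S) (onV f v)
  mapWalk ε = ε
  mapWalk (snoc e w) =
    subst (Walk H (onV f S)) (t-commute f e)
      (snoc (onE f e) (subst (Walk H (onV f S)) (sym (o-commute f e)) (mapWalk w)))

  toNode : V UG → V UH
  toNode (v , w) = onV f v , mapWalk w

  toEdge : E UG → E UH
  toEdge (e , w) = edge-at (toNode (o G e , w)) (onE f e , o-commute f e)

  toEdge-edge-at : ∀ n x → toEdge (edge-at n x) ≡ edge-at (toNode n) (outMap f (proj₁ n) x)
  toEdge-edge-at (_ , w) (e , refl) =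
    cong (edge-at (toNode (o G e , w))) (Out-≡ {H} {y = outMap f (o G e) (e , refl)} refl)

  liftOut-onE : ∀ e → liftOut (o G e) (onE f e , o-commute f e) ≡ (e , refl)
  liftOut-onE e =
    trans (cong (liftOut (o G e)) (Out-≡ {H} refl)) (liftOut-outMap (o G e) (e , refl))

  o-toEdge : ∀ a → o UH (toEdge a) ≡ toNode (o UG a)
  o-toEdge (e , w) = o-edge-at (toNode (o G e , w)) _

  t-toEdge : ∀ a → t UH (toEdge a) ≡ toNode (t UG a)
  t-toEdge (e , _) = Σ-≡,≡→≡ (t-commute f e , refl)

  NodeFibre : V UH → Set
  NodeFibre m = Σ[ n ∈ V UG ] toNode n ≡ m

  EdgeFibre : E UH → Set
  EdgeFibre b = Σ[ a ∈ E UG ] toEdge a ≡ b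

  liftEdgeAt : ∀ m y → NodeFibre m → EdgeFibre (edge-at m y)
  liftEdgeAt _ y (n , refl) = edge-at n x , (begin
      toEdge (edge-at n x)                      ≡⟨ toEdge-edge-at n x ⟩
      edge-at (toNode n) (outMap f (proj₁ n) x)
        ≡⟨ cong (edge-at (toNode n)) (outMap-liftOut (proj₁ n) y) ⟩
      edge-at (toNode n) y                      ∎)
    where
    open ≡-Reasoning
    x = liftOut (proj₁ n) y

  mutual
    liftWalk : ∀ {x} (w' : Walk H (onV f S) x) → NodeFibre (x , w')
    liftWalk ε = (S , ε) , refl
    liftWalk (snoc e' w') = t UG a , trans (sym (t-toEdge a)) (cong (t UH) eq)
      where
      a  = proj₁ (liftEdgeWalk e' w')
      eq = proj₂ (liftEdgeWalk e' w')

    liftEdgeWalk : ∀ e' (w' : Walk H (onV f S) (o H e')) → EdgeFibre (e' , w')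
    liftEdgeWalk e' w' = liftEdgeAt (o H e' , w') (e' , refl) (liftWalk w')

  liftNode : ∀ m → NodeFibre m
  liftNode (_ , w') = liftWalk w'

  liftEdge : ∀ b → EdgeFibre b
  liftEdge (e' , w') = liftEdgeWalk e' w'

  fromNode : V UH → V UG
  fromNode m = proj₁ (liftNode m)

  fromEdge : E UH → E UG
  fromEdge b = proj₁ (liftEdge b)

  fromEdge-edge-at : ∀ m y → fromEdge (edge-at m y) ≡ proj₁ (liftEdgeAt m y (liftNode m))
  fromEdge-edge-at _ (_ , refl) = refl

  liftEdgeAt-toNode : ∀ n y (F : NodeFibre (toNode n)) → proj₁ F ≡ n →
                      proj₁ (liftEdgeAt (toNode n) y F) ≡ edge-at n (liftOut (proj₁ n) y)
  liftEdgeAt-toNode n y (.n , refl) refl = refl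

  mutual
    fromNode-toNode : ∀ {v} (w : Walk G S v) → fromNode (toNode (v , w)) ≡ (v , w)
    fromNode-toNode ε = refl
    fromNode-toNode (snoc e w) = begin
      fromNode (toNode (t UG (e , w)))  ≡⟨ cong fromNode (sym (t-toEdge (e , w))) ⟩
      t UG (fromEdge (toEdge (e , w)))  ≡⟨ cong (t UG) (fromEdge-toEdge e w) ⟩
      t UG (e , w)                      ∎
      where open ≡-Reasoning

    fromEdge-toEdge : ∀ e (w : Walk G S (o G e)) → fromEdge (toEdge (e , w)) ≡ (e , w)
    fromEdge-toEdge e w = begin
      fromEdge (edge-at (toNode n) x)                        ≡⟨ fromEdge-edge-at (toNode n) x ⟩
      proj₁ (liftEdgeAt (toNode n) x (liftNode (toNode n)))
        ≡⟨ liftEdgeAt-toNode n x (liftNode (toNode n)) (fromNode-toNode w) ⟩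
      edge-at n (liftOut (o G e) x)                          ≡⟨ cong (edge-at n) (liftOut-onE e) ⟩
      (e , w)                                                ∎
      where
      open ≡-Reasoning
      n = (o G e , w)
      x = (onE f e , o-commute f e)

  unfoldingIso : RootedIso UG UH (rootOf G S) (rootOf H (onV f S))
  unfoldingIso = record
    { isoV = mk↔ₛ′ toNode fromNode (λ m → proj₂ (liftNode m)) (λ (_ , w) → fromNode-toNode w)
    ; isoE = mk↔ₛ′ toEdge fromEdge (λ b → proj₂ (liftEdge b)) (λ (e , w) → fromEdge-toEdge e w)
    ; pres-o = o-toEdge
    ; pres-t = t-toEdge
    ; pres-root = refl
    }

quotientMorphism : ∀ {G R Q} → IsQuotient G R Q → GraphMorphism G Q
quotientMorphism q = record
  { onV = clsV q ; onE = clsE q ; o-commute = cls-o q ; t-commute = cls-t q }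

module _ {G : Graph} {R : GraphEquiv G} (nec : NonEdgeCollapsing G R)
         {Q : Graph} (q : IsQuotient G R Q) (v : V G) where

  private
    outMapQ = outMap (quotientMorphism q) v

  outMap-injective : Injective _≡_ _≡_ outMapQ
  outMap-injective {e₁ , p₁} {e₂ , p₂} eq =
    Out-≡ {G} (trans (unique e₁ (p₁ , IsEquivalence.refl (isEquivE R)))
                     (sym (unique e₂ (p₂ , clsE-kernel→ q e₁ e₂ (cong proj₁ eq)))))
    where
    unique = proj₂ (proj₂ (nec v v (IsEquivalence.refl (isEquivV R)) e₁ p₁))

  outMap-strictlySurjective : StrictlySurjective _≡_ outMapQ
  outMap-strictlySurjective (e' , p) =
    (e , o-e) , Out-≡ {Q} (trans (sym (clsE-kernel← q e₀ e e₀~e)) cls-e₀)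
    where
    e₀     = proj₁ (clsE-surj q e')
    cls-e₀ = proj₂ (clsE-surj q e')
    o-e₀~v = clsV-kernel→ q (o G e₀) v (trans (sym (cls-o q e₀)) (trans (cong (o Q) cls-e₀) p))
    lifted = nec (o G e₀) v o-e₀~v e₀ refl
    e      = proj₁ lifted
    o-e    = proj₁ (proj₁ (proj₂ lifted))
    e₀~e   = proj₂ (proj₁ (proj₂ lifted))

nonEdgeCollapsing⇒covering : ∀ {G R} → NonEdgeCollapsing G R →
                             ∀ {Q} (q : IsQuotient G R Q) → IsCovering (quotientMorphism q)
nonEdgeCollapsing⇒covering nec q v =
  outMap-injective nec q v , strictlySurjective⇒surjective (outMap-strictlySurjective nec q v)

lemma3 : (G : Graph) (S : V G) → IsRoot G S →
    (R : GraphEquiv G) → NonEdgeCollapsing G R →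
    (Q : Graph) (q : IsQuotient G R Q) →
    RootedIso (Unfolding G S) (Unfolding Q (clsV q S))
    (rootOf G S) (rootOf Q (clsV q S))
lemma3 G S _ R nec Q q =
  CoveringUnfolding.unfoldingIso (quotientMorphism q) (nonEdgeCollapsing⇒covering nec q) S
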